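{- Let $G$ be a finite abelian group of order $n$, let $2\le h\le n-1$, and let $a\in G$. For $1\le k\le n$ and $b\in G$, let $f_b(k)$ denote the number of $k$-element subsets $\{x_1,\dots,x_k\}\subseteq G$ with $x_1+\cdots+x_k=b$. For $x\in G$ let $g^x_a(h,h-1)$ equal $1$ if $hx=a$ and $0$ otherwise. Then \[ f_a(h)=\frac{1}{h}\left(\binom{n}{h-1}-\sum_{i=2}^{h-1}(-1)^{i}\sum_{x\in G} f_{a-ix}(h-i)+(-1)^{h-1}\sum_{x\in G} g^x_a(h,h-1)\right). \]
   Context: $G$ is written additively; $ix$ denotes the $i$-fold sum $x+\cdots+x$. More generally the paper defines, for $1\le i\le h-1$, $g^x_a(h,i)$ as the number of $(h-i)$-element subsets $\{x_1,\dots,x_{h-i}\}\subseteq G$ with $x_1+\cdots+x_{h-i}=a-ix$ and $x\in\{x_1,\dots,x_{h-i}\}$; for $i=h-1$ this equals $1$ if $hx=a$ and $0$ otherwise. -}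

module Defs where

open import Data.Nat as ℕ using (ℕ; zero; suc)
open import Data.Integer as ℤ using (ℤ)
open import Data.Bool using (Bool; true; false; if_then_else_)
open import Data.Fin using (Fin)
open import Data.Fin.Properties using (_≟_)
open import Data.Fin.Subset using (Subset; inside; outside; ∣_∣)
open import Data.Vec using ([]; _∷_; lookup)
open import Data.List using (List; []; _∷_; [_]; _++_; map; foldr; filter; length; allFin)
open import Data.Product using (_×_)
open import Relation.Nullary.Decidable using (_×-dec_; does)
open import Relation.Binary.PropositionalEquality using (_≡_)
open import Algebra.Structures using (IsAbelianGroup)

-- A finite abelian group of order n, with carrier Fin n (every finite group
-- of order n is isomorphic to one of this form), written additively.
record FinAbGroup (n : ℕ) : Set where
  field
    _⊕_ : Fin n → Fin n → Fin n
    𝟘 : Fin n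
    ⊖_ : Fin n → Fin n
    isAbelianGroup : IsAbelianGroup _≡_ _⊕_ 𝟘 ⊖_

allSubsets : (m : ℕ) → List (Subset m)
allSubsets zero = [ [] ]
allSubsets (suc m) = map (outside ∷_) (allSubsets m) ++ map (inside ∷_) (allSubsets m)

sumℤ : List ℤ → ℤ
sumℤ = foldr ℤ._+_ (ℤ.+ 0)

sgn : ℕ → ℤ
sgn zero = ℤ.+ 1
sgn (suc i) = ℤ.- sgn i

module _ {n : ℕ} (G : FinAbGroup n) where
  open FinAbGroup G

  _·_ : ℕ → Fin n → Fin n
  zero · x = 𝟘
  suc i · x = x ⊕ (i · x)

  subsetSum : Subset n → Fin n
  subsetSum p = foldr (λ x acc → if lookup p x then x ⊕ acc else acc) 𝟘 (allFin n)

  f : Fin n → ℕ → ℕ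
  f b k = length (filter (λ p → (∣ p ∣ ℕ.≟ k) ×-dec (subsetSum p ≟ b)) (allSubsets n))

  g : Fin n → ℕ → Fin n → ℕ
  g a h x = if does ((h · x) ≟ a) then 1 else 0

  sumG : (Fin n → ℤ) → ℤ
  sumG φ = sumℤ (map φ (allFin n))

{-# OPTIONS --safe #-}
module Submission where

-- Let Gᵢ = Σₓ g^x_a(h,i) count the pairs (x, S) with |S| = h − i, ΣS = a − ix and x ∈ S.
-- Double counting gives G₀ = h·f_a(h).  Toggling x turns the sets counted by g^x_a(h,i) into
-- the (h−i−1)-sets with sum a − (i+1)x that avoid x, so Gᵢ + Gᵢ₊₁ = Σₓ f_{a−(i+1)x}(h−i−1)
-- for i < h.  At the ends, G₀ + G₁ = Σₓ f_{a−x}(h−1) = C(n,h−1) since x ↦ a − x is a bijection,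
-- and G_h = 0 gives G_{h−1} = #{x : hx = a}.  Finally Σ_{i=2}^{h−1} (−1)^i (Gᵢ₋₁ + Gᵢ)
-- telescopes to G₁ + (−1)^{h−1} G_{h−1}.

open import Defs
open import Algebra.Bundles using (AbelianGroup)
import Algebra.Properties.AbelianGroup as AbelianGroupProperties
import Algebra.Properties.CommutativeSemigroup
open import Data.Bool using (Bool; true; false; _∧_; not; if_then_else_)
open import Data.Bool.Properties using (∧-identityʳ; ∧-zeroʳ)
open import Data.Fin using (Fin; zero; suc)
open import Data.Fin.Properties using (_≟_)
open import Data.Fin.Subset using (Subset; inside; outside; ∣_∣)
open import Data.Integer using (ℤ; +_; -_; _*_; _-_; _+_)
import Data.Integer.Properties as ℤₚ
open import Data.Integer.Tactic.RingSolver using (solve-∀)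
open import Data.List using (List; []; _∷_; _++_; map; foldr; filter; length; allFin; applyUpTo; upTo)
open import Data.List.Properties using (map-cong; map-++; map-∘; map-tabulate; map-upTo)
open import Data.Nat as ℕ using (ℕ; zero; suc; _≤_; _<_; _∸_; z≤n; s≤s)
open import Data.Nat.Combinatorics using (_C_; nCk+nC[k+1]≡[n+1]C[k+1])
open import Data.Nat.ListAction using (sum)
open import Data.Nat.ListAction.Properties using (sum-++)
import Data.Nat.Properties as ℕₚ
open import Data.Vec using ([]; _∷_; lookup; _[_]%=_)
open import Data.Vec.Properties using (lookup∘updateAt; lookup∘updateAt′)
open import Function using (_∘_; id; _⇔_; mk⇔; Equivalence)
open import Relation.Nullary using (Dec; yes; no; does)
open import Relation.Nullary.Decidable using (does-⇔)
open import Relation.Unary using (Decidable)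
open import Relation.Binary.PropositionalEquality
open Algebra.Properties.CommutativeSemigroup ℕₚ.+-commutativeSemigroup
  using () renaming (interchange to +-interchange)
open ≡-Reasoning

private variable
  A B : Set

𝟙 : Bool → ℕ
𝟙 b = if b then 1 else 0

∑ : List A → (A → ℕ) → ℕ
∑ xs φ = sum (map φ xs)

infix 5 ∑
syntax ∑ xs (λ x → e) = ∑[ x ∈ xs ] e

∑-cong : ∀ (xs : List A) {φ ψ : A → ℕ} → (∀ x → φ x ≡ ψ x) → ∑ xs φ ≡ ∑ xs ψ
∑-cong xs φ≗ψ = cong sum (map-cong φ≗ψ xs)

∑-zero : ∀ (xs : List A) {φ : A → ℕ} → (∀ x → φ x ≡ 0) → ∑ xs φ ≡ 0
∑-zero []       _   = refl
∑-zero (x ∷ xs) φ≗0 = cong₂ ℕ._+_ (φ≗0 x) (∑-zero xs φ≗0)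

∑-distrib-+ : ∀ (xs : List A) (φ ψ : A → ℕ) →
              ∑[ x ∈ xs ] (φ x ℕ.+ ψ x) ≡ ∑ xs φ ℕ.+ ∑ xs ψ
∑-distrib-+ []       φ ψ = refl
∑-distrib-+ (x ∷ xs) φ ψ =
  trans (cong (φ x ℕ.+ ψ x ℕ.+_) (∑-distrib-+ xs φ ψ)) (+-interchange (φ x) (ψ x) _ _)

*-distribˡ-∑ : ∀ c (xs : List A) (φ : A → ℕ) → c ℕ.* ∑ xs φ ≡ ∑[ x ∈ xs ] (c ℕ.* φ x)
*-distribˡ-∑ c []       φ = ℕₚ.*-zeroʳ c
*-distribˡ-∑ c (x ∷ xs) φ =
  trans (ℕₚ.*-distribˡ-+ c (φ x) _) (cong (c ℕ.* φ x ℕ.+_) (*-distribˡ-∑ c xs φ))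

∑-comm : ∀ (xs : List A) (ys : List B) (φ : A → B → ℕ) →
         ∑[ x ∈ xs ] ∑ ys (φ x) ≡ ∑[ y ∈ ys ] ∑[ x ∈ xs ] φ x y
∑-comm []       ys φ = sym (∑-zero ys (λ _ → refl))
∑-comm (x ∷ xs) ys φ =
  trans (cong (∑ ys (φ x) ℕ.+_) (∑-comm xs ys φ)) (sym (∑-distrib-+ ys (φ x) _))

∑-++ : ∀ (xs ys : List A) (φ : A → ℕ) → ∑ (xs ++ ys) φ ≡ ∑ xs φ ℕ.+ ∑ ys φ
∑-++ xs ys φ = trans (cong sum (map-++ φ xs ys)) (sum-++ (map φ xs) (map φ ys))

∑-map : ∀ (f : B → A) (xs : List B) (φ : A → ℕ) → ∑ (map f xs) φ ≡ ∑ xs (φ ∘ f)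
∑-map f xs φ = cong sum (sym (map-∘ xs))

length-filter≡∑ : ∀ {P : A → Set} (P? : Decidable P) xs →
                  length (filter P? xs) ≡ ∑[ x ∈ xs ] 𝟙 (does (P? x))
length-filter≡∑ P? []       = refl
length-filter≡∑ P? (x ∷ xs) with does (P? x)
... | true  = cong suc (length-filter≡∑ P? xs)
... | false = length-filter≡∑ P? xs

𝟙-∧ : ∀ p q → 𝟙 (p ∧ q) ≡ 𝟙 p ℕ.* 𝟙 q
𝟙-∧ true  true  = refl
𝟙-∧ true  false = refl
𝟙-∧ false _     = refl

𝟙-split : ∀ p q → 𝟙 p ≡ 𝟙 (p ∧ q) ℕ.+ 𝟙 (p ∧ not q)
𝟙-split false _     = refl
𝟙-split true  true  = refl
𝟙-split true  false = refl

𝟙-∧-∑ : ∀ b (xs : List A) (q : A → Bool) →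
        ∑[ x ∈ xs ] 𝟙 (b ∧ q x) ≡ 𝟙 b ℕ.* (∑[ x ∈ xs ] 𝟙 (q x))
𝟙-∧-∑ b xs q = trans (∑-cong xs (λ x → 𝟙-∧ b (q x))) (sym (*-distribˡ-∑ (𝟙 b) xs (𝟙 ∘ q)))

∑-allFin-suc : ∀ m (φ : Fin (suc m) → ℕ) →
               ∑ (allFin (suc m)) φ ≡ φ zero ℕ.+ (∑[ x ∈ allFin m ] φ (suc x))
∑-allFin-suc m φ =
  cong (φ zero ℕ.+_) (cong sum (trans (map-tabulate suc φ) (sym (map-tabulate id (φ ∘ suc)))))

∑-≟ : ∀ {m} (y : Fin m) → ∑[ x ∈ allFin m ] 𝟙 (does (x ≟ y)) ≡ 1
∑-≟ {suc m} zero    = trans (∑-allFin-suc m (λ x → 𝟙 (does (x ≟ zero))))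
                            (cong suc (∑-zero (allFin m) (λ _ → refl)))
∑-≟ {suc m} (suc y) = trans (∑-allFin-suc m (λ x → 𝟙 (does (x ≟ suc y)))) (∑-≟ y)

∑-lookup : ∀ {m} (p : Subset m) → ∑[ x ∈ allFin m ] 𝟙 (lookup p x) ≡ ∣ p ∣
∑-lookup {zero}  []      = refl
∑-lookup {suc m} (s ∷ p) = trans (∑-allFin-suc m (𝟙 ∘ lookup (s ∷ p))) (add-head s)
  where
  add-head : ∀ s → 𝟙 s ℕ.+ (∑[ x ∈ allFin m ] 𝟙 (lookup p x)) ≡ ∣ s ∷ p ∣
  add-head outside = ∑-lookup p
  add-head inside  = cong suc (∑-lookup p)

∑-allSubsets-suc : ∀ m (φ : Subset (suc m) → ℕ) →
  ∑ (allSubsets (suc m)) φ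
    ≡ (∑[ p ∈ allSubsets m ] φ (outside ∷ p)) ℕ.+ (∑[ p ∈ allSubsets m ] φ (inside ∷ p))
∑-allSubsets-suc m φ =
  trans (∑-++ (map (outside ∷_) (allSubsets m)) (map (inside ∷_) (allSubsets m)) φ)
        (cong₂ ℕ._+_ (∑-map (outside ∷_) (allSubsets m) φ) (∑-map (inside ∷_) (allSubsets m) φ))

∑-∣p∣≟k : ∀ m k → ∑[ p ∈ allSubsets m ] 𝟙 (does (∣ p ∣ ℕ.≟ k)) ≡ m C k
∑-∣p∣≟k zero    zero    = refl
∑-∣p∣≟k zero    (suc k) = refl
∑-∣p∣≟k (suc m) zero    =
  trans (∑-allSubsets-suc m _) (cong₂ ℕ._+_ (∑-∣p∣≟k m 0) (∑-zero (allSubsets m) (λ _ → refl)))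
∑-∣p∣≟k (suc m) (suc k) =
  trans (∑-allSubsets-suc m _)
        (trans (cong₂ ℕ._+_ (∑-∣p∣≟k m (suc k)) (∑-∣p∣≟k m k))
               (trans (ℕₚ.+-comm (m C suc k) (m C k)) (nCk+nC[k+1]≡[n+1]C[k+1] m k)))

toggle : ∀ {m} → Fin m → Subset m → Subset m
toggle x p = p [ x ]%= not

∑-toggle : ∀ {m} (x : Fin m) (φ : Subset m → ℕ) →
           ∑ (allSubsets m) φ ≡ ∑[ p ∈ allSubsets m ] φ (toggle x p)
∑-toggle {suc m} zero φ =
  trans (∑-allSubsets-suc m φ)
        (trans (ℕₚ.+-comm (∑[ p ∈ allSubsets m ] φ (outside ∷ p)) _)
               (sym (∑-allSubsets-suc m (φ ∘ toggle zero))))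
∑-toggle {suc m} (suc x) φ =
  trans (∑-allSubsets-suc m φ)
        (trans (cong₂ ℕ._+_ (∑-toggle x _) (∑-toggle x _))
               (sym (∑-allSubsets-suc m (φ ∘ toggle (suc x)))))

∣toggle∣ : ∀ {m} (x : Fin m) (p : Subset m) → lookup p x ≡ outside → ∣ toggle x p ∣ ≡ suc ∣ p ∣
∣toggle∣ zero    (outside ∷ p) _   = refl
∣toggle∣ (suc x) (outside ∷ p) x∉p = ∣toggle∣ x p x∉p
∣toggle∣ (suc x) (inside ∷ p)  x∉p = cong suc (∣toggle∣ x p x∉p)

∣p∣≡0⇒lookup≡outside : ∀ {m} (p : Subset m) (x : Fin m) → ∣ p ∣ ≡ 0 → lookup p x ≡ outside
∣p∣≡0⇒lookup≡outside (outside ∷ p) zero    _     = refl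
∣p∣≡0⇒lookup≡outside (outside ∷ p) (suc x) ∣p∣≡0 = ∣p∣≡0⇒lookup≡outside p x ∣p∣≡0
∣p∣≡0⇒lookup≡outside (inside ∷ p)  _       ()

sumℤ-pos : ∀ (xs : List A) (φ : A → ℕ) → sumℤ (map (λ x → + φ x) xs) ≡ + ∑ xs φ
sumℤ-pos []       φ = refl
sumℤ-pos (x ∷ xs) φ = trans (cong (_+_ (+ φ x)) (sumℤ-pos xs φ)) (sym (ℤₚ.pos-+ (φ x) (∑ xs φ)))

telescope : ∀ m (φ t : ℕ → ℤ) → (∀ j → j < m → φ j ≡ t j - t (suc j)) →
            sumℤ (applyUpTo φ m) ≡ t 0 - t m
telescope zero    φ t _  = sym (ℤₚ.+-inverseʳ (t 0))
telescope (suc m) φ t φ≡ = begin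
  φ 0 + sumℤ (applyUpTo (φ ∘ suc) m)
    ≡⟨ cong₂ _+_ (φ≡ 0 (s≤s z≤n))
                 (telescope m (φ ∘ suc) (t ∘ suc) (λ j j<m → φ≡ (suc j) (s≤s j<m))) ⟩
  (t 0 - t 1) + (t 1 - t (suc m))  ≡⟨ cancel (t 0) (t 1) (t (suc m)) ⟩
  t 0 - t (suc m)                  ∎
  where
  cancel : ∀ x y z → (x - y) + (y - z) ≡ x - z
  cancel = solve-∀

sgn-alternates : ∀ j u v → sgn (2 ℕ.+ j) * + (u ℕ.+ v) ≡ sgn j * + u - sgn (suc j) * + v
sgn-alternates j u v = begin
  - - sgn j * + (u ℕ.+ v)        ≡⟨ cong₂ _*_ (ℤₚ.neg-involutive (sgn j)) (ℤₚ.pos-+ u v) ⟩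
  sgn j * (+ u + + v)            ≡⟨ distribute (sgn j) (+ u) (+ v) ⟩
  sgn j * + u - (- sgn j) * + v  ∎
  where
  distribute : ∀ s x y → s * (x + y) ≡ s * x - (- s) * y
  distribute = solve-∀

module _ {n : ℕ} (G : FinAbGroup n) where
  open FinAbGroup G

  private
    abelianGroup : AbelianGroup _ _
    abelianGroup = record
      { Carrier = Fin n ; _≈_ = _≡_ ; _∙_ = _⊕_ ; ε = 𝟘 ; _⁻¹ = ⊖_ ; isAbelianGroup = isAbelianGroup }

  open AbelianGroup abelianGroup using (assoc; comm; identityʳ) renaming (_-_ to _⊝_)
  open AbelianGroupProperties abelianGroup using (x≈z//y; //-rightDividesˡ; ε⁻¹≈ε; ⁻¹-∙-comm)
  open Algebra.Properties.CommutativeSemigroup (AbelianGroup.commutativeSemigroup abelianGroup)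
    using (x∙yz≈y∙xz)
  open Equivalence using (to; from)

  x⊕y≡z⇔y≡z⊝x : ∀ x y z → (x ⊕ y ≡ z) ⇔ (y ≡ z ⊝ x)
  x⊕y≡z⇔y≡z⊝x x y z = mk⇔ (λ x⊕y≡z → x≈z//y y x z (trans (comm y x) x⊕y≡z))
                            (λ { refl → trans (comm x _) (//-rightDividesˡ x z) })

  x≡z⊝y⇔y≡z⊝x : ∀ x y z → (x ≡ z ⊝ y) ⇔ (y ≡ z ⊝ x)
  x≡z⊝y⇔y≡z⊝x x y z = mk⇔
    (λ x≡z⊝y → to (x⊕y≡z⇔y≡z⊝x x y z) (trans (comm x y) (from (x⊕y≡z⇔y≡z⊝x y x z) x≡z⊝y)))
    (λ y≡z⊝x → to (x⊕y≡z⇔y≡z⊝x y x z) (trans (comm y x) (from (x⊕y≡z⇔y≡z⊝x x y z) y≡z⊝x)))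

  𝟘≡x⊝y⇔y≡x : ∀ x y → (𝟘 ≡ x ⊝ y) ⇔ (y ≡ x)
  𝟘≡x⊝y⇔y≡x x y = mk⇔ (λ 𝟘≡x⊝y → trans (sym (identityʳ y)) (from (x⊕y≡z⇔y≡z⊝x y 𝟘 x) 𝟘≡x⊝y))
                       (λ y≡x → to (x⊕y≡z⇔y≡z⊝x y 𝟘 x) (trans (identityʳ y) y≡x))

  x⊝y⊝z≡x⊝[z⊕y] : ∀ x y z → x ⊝ y ⊝ z ≡ x ⊝ (z ⊕ y)
  x⊝y⊝z≡x⊝[z⊕y] x y z =
    trans (assoc x (⊖ y) (⊖ z)) (cong (x ⊕_) (trans (comm (⊖ y) (⊖ z)) (⁻¹-∙-comm z y)))

  private
    sumOver : List (Fin n) → Subset n → Fin n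
    sumOver xs p = foldr (λ x acc → if lookup p x then x ⊕ acc else acc) 𝟘 xs

    sumOver-toggle : ∀ xs p x → lookup p x ≡ outside →
      sumOver xs (toggle x p) ≡ _·_ G (∑[ y ∈ xs ] 𝟙 (does (y ≟ x))) x ⊕ sumOver xs p
    sumOver-toggle []       p x _ = sym (identityʳ 𝟘)
    sumOver-toggle (y ∷ xs) p x x∉p with y ≟ x
    ... | yes refl rewrite lookup∘updateAt y {not} p | x∉p =
      trans (cong (y ⊕_) (sumOver-toggle xs p y x∉p)) (sym (assoc y _ _))
    ... | no y≢x rewrite lookup∘updateAt′ y x {not} y≢x p with lookup p y
    ...   | outside = sumOver-toggle xs p x x∉p
    ...   | inside  = trans (cong (y ⊕_) (sumOver-toggle xs p x x∉p)) (x∙yz≈y∙xz y _ _)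

    sumOver-∅ : ∀ xs p → (∀ y → lookup p y ≡ outside) → sumOver xs p ≡ 𝟘
    sumOver-∅ []       p _  = refl
    sumOver-∅ (y ∷ xs) p p∌ rewrite p∌ y = sumOver-∅ xs p p∌

  subsetSum-toggle : ∀ p x → lookup p x ≡ outside → subsetSum G (toggle x p) ≡ x ⊕ subsetSum G p
  subsetSum-toggle p x x∉p = begin
    subsetSum G (toggle x p)  ≡⟨ sumOver-toggle (allFin n) p x x∉p ⟩
    _ ⊕ subsetSum G p         ≡⟨ cong (λ c → _·_ G c x ⊕ subsetSum G p) (∑-≟ x) ⟩
    (x ⊕ 𝟘) ⊕ subsetSum G p   ≡⟨ cong (_⊕ subsetSum G p) (identityʳ x) ⟩
    x ⊕ subsetSum G p         ∎

  subsetSum-∣p∣≡0 : ∀ p → ∣ p ∣ ≡ 0 → subsetSum G p ≡ 𝟘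
  subsetSum-∣p∣≡0 p ∣p∣≡0 = sumOver-∅ (allFin n) p (λ y → ∣p∣≡0⇒lookup≡outside p y ∣p∣≡0)

  hasSizeSum : ℕ → Fin n → Subset n → Bool
  hasSizeSum k b p = does (∣ p ∣ ℕ.≟ k) ∧ does (subsetSum G p ≟ b)

  f≡∑ : ∀ b k → f G b k ≡ ∑[ p ∈ allSubsets n ] 𝟙 (hasSizeSum k b p)
  f≡∑ b k = length-filter≡∑ _ (allSubsets n)

  f∋ f∌ : ℕ → Fin n → Fin n → ℕ
  f∋ k b x = ∑[ p ∈ allSubsets n ] 𝟙 (hasSizeSum k b p ∧ lookup p x)
  f∌ k b x = ∑[ p ∈ allSubsets n ] 𝟙 (hasSizeSum k b p ∧ not (lookup p x))

  f≡f∋+f∌ : ∀ k b x → f G b k ≡ f∋ k b x ℕ.+ f∌ k b x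
  f≡f∋+f∌ k b x = begin
    f G b k                                                          ≡⟨ f≡∑ b k ⟩
    ∑[ p ∈ allSubsets n ] 𝟙 (hasSizeSum k b p)
      ≡⟨ ∑-cong (allSubsets n) (λ p → 𝟙-split _ (lookup p x)) ⟩
    ∑[ p ∈ allSubsets n ] (𝟙 (hasSizeSum k b p ∧ lookup p x) ℕ.+ _)  ≡⟨ ∑-distrib-+ (allSubsets n) _ _ ⟩
    f∋ k b x ℕ.+ f∌ k b x                                            ∎

  ∑-f∋ : ∀ k b → ∑[ x ∈ allFin n ] f∋ k b x ≡ k ℕ.* f G b k
  ∑-f∋ k b = begin
    ∑[ x ∈ allFin n ] f∋ k b x                                    ≡⟨ ∑-comm (allFin n) (allSubsets n) _ ⟩
    ∑[ p ∈ allSubsets n ] ∑[ x ∈ allFin n ] 𝟙 (P p ∧ lookup p x)  ≡⟨ ∑-cong (allSubsets n) count-elements ⟩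
    ∑[ p ∈ allSubsets n ] 𝟙 (P p) ℕ.* ∣ p ∣
      ≡⟨ ∑-cong (allSubsets n) (λ p → size-is-k ∣ p ∣ (∣ p ∣ ℕ.≟ k) _) ⟩
    ∑[ p ∈ allSubsets n ] k ℕ.* 𝟙 (P p)                           ≡⟨ *-distribˡ-∑ k (allSubsets n) _ ⟨
    k ℕ.* (∑[ p ∈ allSubsets n ] 𝟙 (P p))                         ≡⟨ cong (k ℕ.*_) (f≡∑ b k) ⟨
    k ℕ.* f G b k                                                 ∎
    where
    P : Subset n → Bool
    P = hasSizeSum k b
    count-elements : ∀ p → ∑[ x ∈ allFin n ] 𝟙 (P p ∧ lookup p x) ≡ 𝟙 (P p) ℕ.* ∣ p ∣
    count-elements p = trans (𝟙-∧-∑ (P p) (allFin n) (lookup p)) (cong (𝟙 (P p) ℕ.*_) (∑-lookup p))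
    size-is-k : ∀ m (m≟k : Dec (m ≡ k)) q → 𝟙 (does m≟k ∧ q) ℕ.* m ≡ k ℕ.* 𝟙 (does m≟k ∧ q)
    size-is-k m (yes refl) q = ℕₚ.*-comm (𝟙 q) m
    size-is-k m (no _)     q = sym (ℕₚ.*-zeroʳ k)

  f∋-suc : ∀ k b x → f∋ (suc k) b x ≡ f∌ k (b ⊝ x) x
  f∋-suc k b x = trans (∑-toggle x _) (∑-cong (allSubsets n) (λ p → cong 𝟙 (toggled p)))
    where
    toggled-∉ : ∀ p → lookup p x ≡ outside →
                hasSizeSum (suc k) b (toggle x p) ≡ hasSizeSum k (b ⊝ x) p
    toggled-∉ p x∉p = cong₂ _∧_
      (cong (λ m → does (m ℕ.≟ suc k)) (∣toggle∣ x p x∉p))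
      (trans (cong (λ s → does (s ≟ b)) (subsetSum-toggle p x x∉p))
             (does-⇔ (x⊕y≡z⇔y≡z⊝x x (subsetSum G p) b)
                     (x ⊕ subsetSum G p ≟ b) (subsetSum G p ≟ b ⊝ x)))
    toggled : ∀ p → hasSizeSum (suc k) b (toggle x p) ∧ lookup (toggle x p) x
                  ≡ hasSizeSum k (b ⊝ x) p ∧ not (lookup p x)
    toggled p rewrite lookup∘updateAt x {not} p with lookup p x in x∈?p
    ... | inside  = trans (∧-zeroʳ _) (sym (∧-zeroʳ _))
    ... | outside = cong (_∧ true) (toggled-∉ p x∈?p)

  f∋-zero : ∀ b x → f∋ 0 b x ≡ 0
  f∋-zero b x = ∑-zero (allSubsets n) (λ p → cong 𝟙 (empty-∌ p (∣ p ∣ ℕ.≟ 0)))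
    where
    empty-∌ : ∀ p (∣p∣≟0 : Dec (∣ p ∣ ≡ 0)) →
              (does ∣p∣≟0 ∧ does (subsetSum G p ≟ b)) ∧ lookup p x ≡ false
    empty-∌ p (yes ∣p∣≡0) = trans (cong (_ ∧_) (∣p∣≡0⇒lookup≡outside p x ∣p∣≡0)) (∧-zeroʳ _)
    empty-∌ p (no _)      = refl

  f-zero : ∀ b → f G b 0 ≡ 𝟙 (does (𝟘 ≟ b))
  f-zero b = begin
    f G b 0                                                   ≡⟨ f≡∑ b 0 ⟩
    ∑[ p ∈ allSubsets n ] 𝟙 (hasSizeSum 0 b p)                ≡⟨ ∑-cong (allSubsets n) empty-sum ⟩
    ∑[ p ∈ allSubsets n ] 𝟙 (𝟘≡b ∧ does (∣ p ∣ ℕ.≟ 0))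
      ≡⟨ 𝟙-∧-∑ 𝟘≡b (allSubsets n) (λ p → does (∣ p ∣ ℕ.≟ 0)) ⟩
    𝟙 𝟘≡b ℕ.* (∑[ p ∈ allSubsets n ] 𝟙 (does (∣ p ∣ ℕ.≟ 0)))  ≡⟨ cong (𝟙 𝟘≡b ℕ.*_) (∑-∣p∣≟k n 0) ⟩
    𝟙 𝟘≡b ℕ.* 1                                               ≡⟨ ℕₚ.*-identityʳ (𝟙 𝟘≡b) ⟩
    𝟙 𝟘≡b                                                     ∎
    where
    𝟘≡b = does (𝟘 ≟ b)
    empty-sum′ : ∀ p (∣p∣≟0 : Dec (∣ p ∣ ≡ 0)) →
                 does ∣p∣≟0 ∧ does (subsetSum G p ≟ b) ≡ 𝟘≡b ∧ does ∣p∣≟0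
    empty-sum′ p (yes ∣p∣≡0) =
      trans (cong (λ s → does (s ≟ b)) (subsetSum-∣p∣≡0 p ∣p∣≡0)) (sym (∧-identityʳ 𝟘≡b))
    empty-sum′ p (no _)      = sym (∧-zeroʳ 𝟘≡b)
    empty-sum : ∀ p → 𝟙 (hasSizeSum 0 b p) ≡ 𝟙 (𝟘≡b ∧ does (∣ p ∣ ℕ.≟ 0))
    empty-sum p = cong 𝟙 (empty-sum′ p (∣ p ∣ ℕ.≟ 0))

  ∑-f[a⊝x] : ∀ a k → ∑[ x ∈ allFin n ] f G (a ⊝ x) k ≡ n C k
  ∑-f[a⊝x] a k = begin
    ∑[ x ∈ allFin n ] f G (a ⊝ x) k
      ≡⟨ ∑-cong (allFin n) (λ x → f≡∑ (a ⊝ x) k) ⟩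
    ∑[ x ∈ allFin n ] ∑[ p ∈ allSubsets n ] 𝟙 (hasSizeSum k (a ⊝ x) p)
      ≡⟨ ∑-comm (allFin n) (allSubsets n) _ ⟩
    ∑[ p ∈ allSubsets n ] ∑[ x ∈ allFin n ] 𝟙 (hasSizeSum k (a ⊝ x) p)
      ≡⟨ ∑-cong (allSubsets n) one-x-per-subset ⟩
    ∑[ p ∈ allSubsets n ] 𝟙 (does (∣ p ∣ ℕ.≟ k))
      ≡⟨ ∑-∣p∣≟k n k ⟩
    n C k
      ∎
    where
    one-x-per-subset : ∀ p → ∑[ x ∈ allFin n ] 𝟙 (hasSizeSum k (a ⊝ x) p) ≡ 𝟙 (does (∣ p ∣ ℕ.≟ k))
    one-x-per-subset p = begin
      ∑[ x ∈ allFin n ] 𝟙 (d ∧ does (s ≟ a ⊝ x))       ≡⟨ 𝟙-∧-∑ d (allFin n) (λ x → does (s ≟ a ⊝ x)) ⟩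
      𝟙 d ℕ.* (∑[ x ∈ allFin n ] 𝟙 (does (s ≟ a ⊝ x)))  ≡⟨ cong (𝟙 d ℕ.*_) (∑-cong (allFin n) reflect) ⟩
      𝟙 d ℕ.* (∑[ x ∈ allFin n ] 𝟙 (does (x ≟ a ⊝ s)))  ≡⟨ cong (𝟙 d ℕ.*_) (∑-≟ (a ⊝ s)) ⟩
      𝟙 d ℕ.* 1                                        ≡⟨ ℕₚ.*-identityʳ (𝟙 d) ⟩
      𝟙 d                                              ∎
      where
      d = does (∣ p ∣ ℕ.≟ k)
      s = subsetSum G p
      reflect : ∀ x → 𝟙 (does (s ≟ a ⊝ x)) ≡ 𝟙 (does (x ≟ a ⊝ s))
      reflect x = cong 𝟙 (does-⇔ (x≡z⊝y⇔y≡z⊝x s x a) (s ≟ a ⊝ x) (x ≟ a ⊝ s))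

  gᵢ : Fin n → ℕ → ℕ → Fin n → ℕ
  gᵢ a h i x = f∋ (h ∸ i) (a ⊝ _·_ G i x) x

  gᵢ+gᵢ₊₁ : ∀ a h i x → i < h →
            gᵢ a h i x ℕ.+ gᵢ a h (suc i) x ≡ f G (a ⊝ _·_ G (suc i) x) (h ∸ suc i)
  gᵢ+gᵢ₊₁ a h i x i<h = begin
    gᵢ a h i x ℕ.+ f∋ k b x  ≡⟨ cong (ℕ._+ f∋ k b x) gᵢ≡f∌ ⟩
    f∌ k b x ℕ.+ f∋ k b x    ≡⟨ ℕₚ.+-comm (f∌ k b x) (f∋ k b x) ⟩
    f∋ k b x ℕ.+ f∌ k b x    ≡⟨ f≡f∋+f∌ k b x ⟨
    f G b k                  ∎
    where
    k = h ∸ suc i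
    b = a ⊝ _·_ G (suc i) x
    gᵢ≡f∌ : gᵢ a h i x ≡ f∌ k b x
    gᵢ≡f∌ = begin
      f∋ (h ∸ i) (a ⊝ _·_ G i x) x
        ≡⟨ cong (λ m → f∋ m (a ⊝ _·_ G i x) x) (ℕₚ.+-∸-assoc 1 i<h) ⟩
      f∋ (suc k) (a ⊝ _·_ G i x) x
        ≡⟨ f∋-suc k (a ⊝ _·_ G i x) x ⟩
      f∌ k (a ⊝ _·_ G i x ⊝ x) x
        ≡⟨ cong (λ c → f∌ k c x) (x⊝y⊝z≡x⊝[z⊕y] a (_·_ G i x) x) ⟩
      f∌ k b x
        ∎

  ∑g ∑f : Fin n → ℕ → ℕ → ℕ
  ∑g a h i = ∑[ x ∈ allFin n ] gᵢ a h i x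
  ∑f a h i = ∑[ x ∈ allFin n ] f G (a ⊝ _·_ G i x) (h ∸ i)

  ∑g-zero : ∀ a h → ∑g a h 0 ≡ h ℕ.* f G a h
  ∑g-zero a h = trans (∑-cong (allFin n) (λ x → cong (λ c → f∋ h c x) a⊝𝟘≡a)) (∑-f∋ h a)
    where
    a⊝𝟘≡a : a ⊝ 𝟘 ≡ a
    a⊝𝟘≡a = trans (cong (a ⊕_) ε⁻¹≈ε) (identityʳ a)

  ∑g+∑g : ∀ a h i → i < h → ∑g a h i ℕ.+ ∑g a h (suc i) ≡ ∑f a h (suc i)
  ∑g+∑g a h i i<h = trans (sym (∑-distrib-+ (allFin n) (gᵢ a h i) (gᵢ a h (suc i))))
                          (∑-cong (allFin n) (λ x → gᵢ+gᵢ₊₁ a h i x i<h))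

  ∑g₀+∑g₁ : ∀ a h → 0 < h → ∑g a h 0 ℕ.+ ∑g a h 1 ≡ n C (h ∸ 1)
  ∑g₀+∑g₁ a h 0<h = begin
    ∑g a h 0 ℕ.+ ∑g a h 1                        ≡⟨ ∑g+∑g a h 0 0<h ⟩
    ∑[ x ∈ allFin n ] f G (a ⊝ (x ⊕ 𝟘)) (h ∸ 1)
      ≡⟨ ∑-cong (allFin n) (λ x → cong (λ y → f G (a ⊝ y) (h ∸ 1)) (identityʳ x)) ⟩
    ∑[ x ∈ allFin n ] f G (a ⊝ x) (h ∸ 1)        ≡⟨ ∑-f[a⊝x] a (h ∸ 1) ⟩
    n C (h ∸ 1)                                  ∎

  ∑g-last : ∀ a m → ∑g a (suc m) m ≡ ∑[ x ∈ allFin n ] g G a (suc m) x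
  ∑g-last a m = begin
    ∑g a h m                     ≡⟨ ℕₚ.+-identityʳ (∑g a h m) ⟨
    ∑g a h m ℕ.+ 0               ≡⟨ cong (∑g a h m ℕ.+_) ∑g-self ⟨
    ∑g a h m ℕ.+ ∑g a h h        ≡⟨ ∑g+∑g a h m ℕₚ.≤-refl ⟩
    ∑f a h h                     ≡⟨ ∑-cong (allFin n) f[a⊝hx]≡g ⟩
    ∑[ x ∈ allFin n ] g G a h x  ∎
    where
    h = suc m
    ∑g-self : ∑g a h h ≡ 0
    ∑g-self = ∑-zero (allFin n)
      (λ x → trans (cong (λ k → f∋ k (a ⊝ _·_ G h x) x) (ℕₚ.n∸n≡0 h)) (f∋-zero _ x))
    f[a⊝hx]≡g : ∀ x → f G (a ⊝ _·_ G h x) (h ∸ h) ≡ g G a h x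
    f[a⊝hx]≡g x = begin
      f G (a ⊝ _·_ G h x) (h ∸ h)   ≡⟨ cong (f G (a ⊝ _·_ G h x)) (ℕₚ.n∸n≡0 h) ⟩
      f G (a ⊝ _·_ G h x) 0         ≡⟨ f-zero (a ⊝ _·_ G h x) ⟩
      𝟙 (does (𝟘 ≟ a ⊝ _·_ G h x))
        ≡⟨ cong 𝟙 (does-⇔ (𝟘≡x⊝y⇔y≡x a (_·_ G h x)) (𝟘 ≟ a ⊝ _·_ G h x) (_·_ G h x ≟ a)) ⟩
      g G a h x                     ∎

  alternating-sum : ∀ a p →
    sumℤ (map (λ j → sgn (2 ℕ.+ j) * sumG G (λ x → + f G (a ⊝ _·_ G (2 ℕ.+ j) x) (2 ℕ.+ p ∸ (2 ℕ.+ j))))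
              (upTo p))
      ≡ + ∑g a (2 ℕ.+ p) 1 - sgn p * + ∑g a (2 ℕ.+ p) (suc p)
  alternating-sum a p = begin
    _                                      ≡⟨ cong sumℤ (map-cong ∑f-pos (upTo p)) ⟩
    sumℤ (map ψ (upTo p))                  ≡⟨ cong sumℤ (map-upTo ψ p) ⟩
    sumℤ (applyUpTo ψ p)                   ≡⟨ telescope p ψ t step ⟩
    sgn 0 * + ∑g a h 1 - t p               ≡⟨ cong (_- t p) (ℤₚ.*-identityˡ (+ ∑g a h 1)) ⟩
    + ∑g a h 1 - sgn p * + ∑g a h (suc p)  ∎
    where
    h = 2 ℕ.+ p
    ψ t : ℕ → ℤ
    ψ j = sgn (2 ℕ.+ j) * + ∑f a h (2 ℕ.+ j)
    t j = sgn j * + ∑g a h (suc j)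
    ∑f-pos : ∀ j → sgn (2 ℕ.+ j) * sumG G (λ x → + f G (a ⊝ _·_ G (2 ℕ.+ j) x) (h ∸ (2 ℕ.+ j))) ≡ ψ j
    ∑f-pos j = cong (sgn (2 ℕ.+ j) *_) (sumℤ-pos (allFin n) _)
    step : ∀ j → j < p → ψ j ≡ t j - t (suc j)
    step j j<p =
      trans (cong (λ m → sgn (2 ℕ.+ j) * + m) (sym (∑g+∑g a h (suc j) (s≤s (s≤s (ℕₚ.<⇒≤ j<p))))))
            (sgn-alternates j (∑g a h (suc j)) (∑g a h (2 ℕ.+ j)))

lemma1 : (n : ℕ) (G : FinAbGroup n) (h : ℕ) → 2 ≤ h → h ≤ n ∸ 1 → (a : Fin n) →
    + h * + f G a h
      ≡ (+ (n C (h ∸ 1))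
         - sumℤ (map (λ j → sgn (2 ℕ.+ j) * sumG G (λ x → + f G (FinAbGroup._⊕_ G a (FinAbGroup.⊖_ G (_·_ G (2 ℕ.+ j) x))) (h ∸ (2 ℕ.+ j)))) (upTo (h ∸ 2))))
        + sgn (h ∸ 1) * sumG G (λ x → + g G a h x)
lemma1 n G h@(suc (suc p)) (s≤s (s≤s _)) _ a = begin
  + h * + f G a h                                               ≡⟨ ℤₚ.pos-* h (f G a h) ⟨
  + (h ℕ.* f G a h)                                             ≡⟨ cong +_ (∑g-zero G a h) ⟨
  + g₀                                                          ≡⟨ rearrange (+ g₀) (+ g₁) (sgn p) (+ gₗ) ⟩
  ((+ g₀ + + g₁) - (+ g₁ - sgn p * + gₗ)) + sgn (suc p) * + gₗ
    ≡⟨ cong₂ _+_ (cong₂ _-_ first (alternating-sum G a p)) (cong (sgn (suc p) *_) last) ⟨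
  _                                                             ∎
  where
  g₀ g₁ gₗ : ℕ
  g₀ = ∑g G a h 0
  g₁ = ∑g G a h 1
  gₗ = ∑g G a h (suc p)
  rearrange : ∀ x y s z → x ≡ ((x + y) - (y - s * z)) + (- s) * z
  rearrange = solve-∀
  first : + (n C (h ∸ 1)) ≡ + g₀ + + g₁
  first = trans (cong +_ (sym (∑g₀+∑g₁ G a h (s≤s z≤n)))) (ℤₚ.pos-+ g₀ g₁)
  last : sumG G (λ x → + g G a h x) ≡ + gₗ
  last = trans (sumℤ-pos (allFin n) (g G a h)) (cong +_ (sym (∑g-last G a (suc p))))
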